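{- Let $H$ be a connected framework for an $n$-connected matroid $N$ with $|V(H)|\ge n$. If $H$ is unbalanced, then every set $X\subseteq E(H)$ such that $H\setminus X$ is balanced satisfies $r_N(X)\ge n$.
   Context: Graphs may have loops and parallel edges. A graph $H$ is a framework for a matroid $N$ if (QG1) $E(H)=E(N)$; (QG2) $r_N(E(H'))\le |V(H')|$ for each component $H'$ of $H$; (QG3) for each vertex $v$, $\mathrm{cl}_N(E(H-v))\subseteq E(H-v)\cup \mathrm{loops}_H(v)$, where $\mathrm{loops}_H(v)$ is the set of loops at $v$; (QG4) for each circuit $C$ of $N$, $H[C]$ has at most two components. A cycle of $H$ is balanced if its edge set is a circuit of $N$, unbalanced otherwise; a subgraph is balanced if all its cycles are balanced, and unbalanced otherwise. Matroid connectivity is in the sense of Tutte. -}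

module Defs where

open import Data.Nat using (ℕ; zero; suc; _+_; _≤_; _<_)
open import Data.Fin using (Fin; _≟_)
open import Data.Fin.Subset using (Subset; _∈_; _∉_; _⊆_; _∪_; _∩_; ∁; ⁅_⁆; ∣_∣; ⊤; Nonempty)
open import Data.Bool using (Bool; true; false; if_then_else_; not; _∧_; _∨_)
open import Data.Vec using (Vec; tabulate; lookup)
open import Data.List using (List; map; allFin)
open import Data.Nat.ListAction using (sum)
open import Data.Product using (_×_; _,_; proj₁; proj₂; ∃; Σ)
open import Data.Sum using (_⊎_)
open import Relation.Nullary using (¬_; Dec; yes; no)
open import Relation.Nullary.Decidable using (⌊_⌋)
open import Relation.Binary.PropositionalEquality using (_≡_; _≢_)

record Matroid (m : ℕ) : Set where
  field
    rank      : Subset m → ℕ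
    rank-≤    : ∀ X → rank X ≤ ∣ X ∣
    rank-mono : ∀ X Y → X ⊆ Y → rank X ≤ rank Y
    rank-sub  : ∀ X Y → rank (X ∪ Y) + rank (X ∩ Y) ≤ rank X + rank Y

module _ {m : ℕ} (N : Matroid m) where
  open Matroid N

  Independent : Subset m → Set
  Independent X = rank X ≡ ∣ X ∣

  Circuit : Subset m → Set
  Circuit C = ¬ Independent C × (∀ D → D ⊆ C → D ≢ C → Independent D)

  InClosure : Subset m → Fin m → Set
  InClosure X e = rank (X ∪ ⁅ e ⁆) ≡ rank X

  Separation : ℕ → Subset m → Set
  Separation k A = k ≤ ∣ A ∣ × k ≤ ∣ ∁ A ∣ × rank A + rank (∁ A) < rank ⊤ + k

  NConnected : ℕ → Set
  NConnected n = ∀ k A → 1 ≤ k → k < n → ¬ Separation k A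

-- Graphs with vertex set Fin v and edge set Fin m (loops and parallel
-- edges allowed); each edge has an (unordered) pair of ends.

record Graph (v m : ℕ) : Set where
  field
    ends : Fin m → Fin v × Fin v

module _ {v m : ℕ} (H : Graph v m) where
  open Graph H

  end₁ end₂ : Fin m → Fin v
  end₁ e = proj₁ (ends e)
  end₂ e = proj₂ (ends e)

  Joins : Fin m → Fin v → Fin v → Set
  Joins e x y = (end₁ e ≡ x × end₂ e ≡ y) ⊎ (end₁ e ≡ y × end₂ e ≡ x)

  Incident : Fin m → Fin v → Set
  Incident e x = end₁ e ≡ x ⊎ end₂ e ≡ x

  incident? : Fin m → Fin v → Bool
  incident? e x = ⌊ end₁ e ≟ x ⌋ ∨ ⌊ end₂ e ≟ x ⌋

  edgesAvoiding : Fin v → Subset m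
  edgesAvoiding x = tabulate (λ e → not (incident? e x))

  IsLoopAt : Fin m → Fin v → Set
  IsLoopAt e x = end₁ e ≡ x × end₂ e ≡ x

  data Reach (F : Subset m) : Fin v → Fin v → Set where
    here : ∀ {x} → Reach F x x
    step : ∀ {x y z} e → e ∈ F → Joins e x y → Reach F y z → Reach F x z

  Connected : Set
  Connected = ∀ x y → Reach ⊤ x y

  InVertexSet : Subset m → Fin v → Set
  InVertexSet F x = ∃ λ e → e ∈ F × Incident e x

  AtMostTwoComponents : Subset m → Set
  AtMostTwoComponents F =
    ∀ x y z → InVertexSet F x → InVertexSet F y → InVertexSet F z →
      Reach F x y ⊎ Reach F y z ⊎ Reach F x z

  -- degree of x in H[F]; a loop counts twice
  deg : Subset m → Fin v → ℕ
  deg F x = sum (map (λ e → if lookup F e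
                              then (if ⌊ end₁ e ≟ x ⌋ then 1 else 0)
                                 + (if ⌊ end₂ e ≟ x ⌋ then 1 else 0)
                              else 0) (allFin m))

  IsCycle : Subset m → Set
  IsCycle C = Nonempty C
            × (∀ x → deg C x ≡ 0 ⊎ deg C x ≡ 2)
            × (∀ x y → InVertexSet C x → InVertexSet C y → Reach C x y)

module _ {v m : ℕ} (H : Graph v m) (N : Matroid m) where
  open Matroid N

  -- (QG2)-(QG4); (QG1) is built in by using the common ground set Fin m.
  -- A component of H is given by a vertex x: its vertex set is Vs and edge
  -- set Es (the edges with both ends in Vs).
  IsFramework : Set
  IsFramework =
      (∀ x (Vs : Subset v) (Es : Subset m) →
         (∀ y → (y ∈ Vs → Reach H ⊤ x y) × (Reach H ⊤ x y → y ∈ Vs)) →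
         (∀ e → (e ∈ Es → end₁ H e ∈ Vs × end₂ H e ∈ Vs)
              × (end₁ H e ∈ Vs × end₂ H e ∈ Vs → e ∈ Es)) →
         rank Es ≤ ∣ Vs ∣)
    × (∀ x e → InClosure N (edgesAvoiding H x) e →
         e ∈ edgesAvoiding H x ⊎ IsLoopAt H e x)
    × (∀ C → Circuit N C → AtMostTwoComponents H C)

  BalancedCycle : Subset m → Set
  BalancedCycle C = Circuit N C

  BalancedDel : Subset m → Set
  BalancedDel X = ∀ C → IsCycle H C → (∀ e → e ∈ C → e ∉ X) → BalancedCycle C

  Unbalanced : Set
  Unbalanced = ∃ λ C → IsCycle H C × ¬ BalancedCycle C

module Submission where

-- Write r for the rank function of N and v = |V(H)|. By (QG2), r(E) ≤ v. Conversely, grow a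
-- vertex set W one vertex z at a time along edges of H: by (QG3) the edge reaching z is not
-- spanned by the edges chosen so far, since those all avoid z. Growing from the vertex set of the
-- unbalanced cycle C, which is independent because every proper subset of a cycle is (by the
-- same argument inside the cycle), gives r(E) ≥ |C| + (v − |V(C)|) = v.
-- If H \ X is balanced, grow a tree T from a vertex inside H \ X until it spans the component W:
-- any other edge of E − X inside W is spanned by T, as otherwise its fundamental cycle would be an
-- unbalanced cycle avoiding X, and the edges outside W have rank at most v − |W|. Hence
-- r(E − X) < r(E), and if r(X) < n then (X, E − X) would be a k-separation with
-- k = r(X) + r(E − X) − r(E) + 1 ≤ r(X) < n.

open import Defs

open import Data.Nat using (ℕ; zero; suc; _+_; _*_; _≤_; _<_; _<ᵇ_; _≤?_; z≤n; s≤s) renaming (_≟_ to _≟ℕ_)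
open import Data.Nat.Properties hiding (_≟_)
open import Data.Fin using (Fin; zero; suc; _≟_)
open import Data.Fin.Properties using (any?)
open import Data.Fin.Subset using (Subset; _∈_; _∉_; _⊆_; _∪_; _∩_; ∁; _-_; ⁅_⁆; ∣_∣; ⊥; ⊤; Nonempty; Empty)
open import Data.Fin.Subset.Properties using (∉⊥; p─⊥≡p; x∈⁅y⁆⇒x≡y; x∈⁅x⁆; ∣⁅x⁆∣≡1; ∣⊥∣≡0; p⊆p∪q; q⊆p∪q; x∈p∪q⁻;
         x∈p∩q⁺; x∈p∩q⁻; ∣p∣≤n; ∣⊤∣≡n; ⊆⊤; x∈∁p⇒x∉p; x∉p⇒x∈∁p; p⊆q⇒∣p∣≤∣q∣; nonempty?; Empty-unique; p∪∁p≡⊤; ∪-identityʳ; ∪-identityˡ; ⊆-antisym; ∪-assoc;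
         p─q⊆p; x∈p∧x≢y⇒x∈p-y; ∈⊤; x∈p⇒∣p-x∣<∣p∣; _∈?_)
open import Data.Bool using (Bool; true; false; if_then_else_; _∨_; not)
open import Data.Bool.Properties using (∨-zeroʳ; ¬-not)
open import Data.Nat.Solver using (module +-*-Solver)
open +-*-Solver using (solve; _:+_; _:*_; _:=_; con)
open import Data.Vec using ([]; _∷_; here; there; lookup; tabulate)
open import Data.Vec.Properties using (lookup∘tabulate; lookup⇒[]=; []=⇒lookup; lookup-replicate; lookup-zipWith)
open import Data.Product using (Σ; _×_; _,_; ∃; proj₁; proj₂; map; map₂)
open import Data.Sum using (_⊎_; inj₁; inj₂)
open import Data.Empty using (⊥-elim)
open import Data.Unit using () renaming (⊤ to Unit)
open import Function using (_∘_; id)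
import Data.List as List using (tabulate)
open import Data.Nat.ListAction using (sum)
open import Data.List.Properties using (map-tabulate)
open import Relation.Unary using (Decidable)
open import Relation.Nullary using (¬_; ¬?; yes; no; contradiction; _×-dec_; _⊎-dec_)
open import Relation.Nullary.Decidable using (⌊_⌋; ⌊⌋-map′)
open import Relation.Binary.PropositionalEquality
open import Algebra.Properties.CommutativeSemigroup +-commutativeSemigroup using (interchange; x∙yz≈y∙xz)

private variable
  n : ℕ

-- Sums over subsets and cardinalities

𝟙 : Bool → ℕ
𝟙 b = if b then 1 else 0

Disjoint : Subset n → Subset n → Set
Disjoint A B = ∀ {i} → i ∈ A → i ∉ B

sumOver : Subset n → (Fin n → ℕ) → ℕ
sumOver []      f = 0
sumOver (b ∷ A) f = (if b then f zero else 0) + sumOver A (f ∘ suc)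

syntax sumOver A (λ i → x) = ∑[ i ∈ A ] x

𝟙-∨ : ∀ a b → (a ≡ true → b ≡ false) → 𝟙 (a ∨ b) ≡ 𝟙 a + 𝟙 b
𝟙-∨ true  b a⇒¬b rewrite a⇒¬b refl = refl
𝟙-∨ false b _    = refl

sumOver-cong : ∀ (A : Subset n) {f g : Fin n → ℕ} → (∀ {i} → i ∈ A → f i ≡ g i) → sumOver A f ≡ sumOver A g
sumOver-cong []          f≗g = refl
sumOver-cong (true ∷ A)  f≗g = cong₂ _+_ (f≗g here) (sumOver-cong A (f≗g ∘ there))
sumOver-cong (false ∷ A) f≗g = sumOver-cong A (f≗g ∘ there)

sumOver-+ : ∀ (A : Subset n) (f g : Fin n → ℕ) → ∑[ i ∈ A ] (f i + g i) ≡ sumOver A f + sumOver A g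
sumOver-+ []          f g = refl
sumOver-+ (true ∷ A)  f g =
  trans (cong (f zero + g zero +_) (sumOver-+ A (f ∘ suc) (g ∘ suc))) (interchange (f zero) (g zero) _ _)
sumOver-+ (false ∷ A) f g = sumOver-+ A (f ∘ suc) (g ∘ suc)

sumOver-*ˡ : ∀ (A : Subset n) c (f : Fin n → ℕ) → ∑[ i ∈ A ] (c * f i) ≡ c * sumOver A f
sumOver-*ˡ []          c f = sym (*-zeroʳ c)
sumOver-*ˡ (true ∷ A)  c f = trans (cong (c * f zero +_) (sumOver-*ˡ A c (f ∘ suc))) (sym (*-distribˡ-+ c _ _))
sumOver-*ˡ (false ∷ A) c f = sumOver-*ˡ A c (f ∘ suc)

sumOver-zero : ∀ (A : Subset n) → ∑[ i ∈ A ] 0 ≡ 0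
sumOver-zero []          = refl
sumOver-zero (true ∷ A)  = sumOver-zero A
sumOver-zero (false ∷ A) = sumOver-zero A

sumOver-⊥ : ∀ (f : Fin n → ℕ) → sumOver ⊥ f ≡ 0
sumOver-⊥ {zero}  f = refl
sumOver-⊥ {suc n} f = sumOver-⊥ (f ∘ suc)

sumOver-⁅⁆ : ∀ (i : Fin n) (f : Fin n → ℕ) → sumOver ⁅ i ⁆ f ≡ f i
sumOver-⁅⁆ zero    f = trans (cong (f zero +_) (sumOver-⊥ (f ∘ suc))) (+-identityʳ _)
sumOver-⁅⁆ (suc i) f = sumOver-⁅⁆ i (f ∘ suc)

∣p∣≡∑1 : ∀ (A : Subset n) → ∣ A ∣ ≡ ∑[ i ∈ A ] 1
∣p∣≡∑1 []          = refl
∣p∣≡∑1 (true ∷ A)  = cong suc (∣p∣≡∑1 A)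
∣p∣≡∑1 (false ∷ A) = ∣p∣≡∑1 A

sumOver-∪ : ∀ (A B : Subset n) (f : Fin n → ℕ) → Disjoint A B → sumOver (A ∪ B) f ≡ sumOver A f + sumOver B f
sumOver-∪ []          []          f A#B = refl
sumOver-∪ (true ∷ A)  (true ∷ B)  f A#B = ⊥-elim (A#B here here)
sumOver-∪ (true ∷ A)  (false ∷ B) f A#B =
  trans (cong (f zero +_) (sumOver-∪ A B (f ∘ suc) (λ i∈A i∈B → A#B (there i∈A) (there i∈B))))
        (sym (+-assoc (f zero) _ _))
sumOver-∪ (false ∷ A) (true ∷ B)  f A#B =
  trans (cong (f zero +_) (sumOver-∪ A B (f ∘ suc) (λ i∈A i∈B → A#B (there i∈A) (there i∈B))))
        (x∙yz≈y∙xz (f zero) (sumOver A (f ∘ suc)) (sumOver B (f ∘ suc)))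
sumOver-∪ (false ∷ A) (false ∷ B) f A#B = sumOver-∪ A B (f ∘ suc) (λ i∈A i∈B → A#B (there i∈A) (there i∈B))

term≤sumOver : ∀ {A : Subset n} {i} (f : Fin n → ℕ) → i ∈ A → f i ≤ sumOver A f
term≤sumOver {A = true ∷ A} f here      = m≤m+n _ _
term≤sumOver {A = b ∷ A}    f (there i∈A) = m≤n⇒m≤o+n _ (term≤sumOver (f ∘ suc) i∈A)

sumOver-positive : ∀ (A : Subset n) (f : Fin n → ℕ) → 0 < sumOver A f → ∃ λ i → i ∈ A × 0 < f i
sumOver-positive (true ∷ A)  f pos with f zero in f₀
... | suc _ = zero , here , subst (0 <_) (sym f₀) (s≤s z≤n)
... | zero  with sumOver-positive A (f ∘ suc) pos
...   | i , i∈A , fi = suc i , there i∈A , fi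
sumOver-positive (false ∷ A) f pos with sumOver-positive A (f ∘ suc) pos
... | i , i∈A , fi = suc i , there i∈A , fi

sumOver-remove : ∀ {A : Subset n} {i} (f : Fin n → ℕ) → i ∈ A → sumOver A f ≡ f i + sumOver (A - i) f
sumOver-remove {A = true ∷ A} f here = cong (λ B → f zero + sumOver B (f ∘ suc)) (sym (p─⊥≡p A))
sumOver-remove {A = true ∷ A}  {suc i} f (there i∈A) =
  trans (cong (f zero +_) (sumOver-remove (f ∘ suc) i∈A)) (x∙yz≈y∙xz (f zero) (f (suc i)) (sumOver (A - i) (f ∘ suc)))
sumOver-remove {A = false ∷ A} {suc i} f (there i∈A) = sumOver-remove (f ∘ suc) i∈A

sumOver-comm : ∀ {k} (A : Subset n) (B : Subset k) (f : Fin n → Fin k → ℕ) →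
  ∑[ i ∈ A ] ∑[ j ∈ B ] f i j ≡ ∑[ j ∈ B ] ∑[ i ∈ A ] f i j
sumOver-comm []          B f = sym (sumOver-zero B)
sumOver-comm (true ∷ A)  B f =
  trans (cong (sumOver B (f zero) +_) (sumOver-comm A B (f ∘ suc))) (sym (sumOver-+ B (f zero) _))
sumOver-comm (false ∷ A) B f = sumOver-comm A B (f ∘ suc)

sumOver-indicator : ∀ (A : Subset n) a → ∑[ x ∈ A ] 𝟙 ⌊ a ≟ x ⌋ ≡ 𝟙 (lookup A a)
sumOver-indicator (true ∷ A)  zero    = cong suc (sumOver-zero A)
sumOver-indicator (false ∷ A) zero    = sumOver-zero A
sumOver-indicator (true ∷ A)  (suc a) = trans (sumOver-cong A (λ {x} _ → cong 𝟙 (⌊⌋-map′ _ _ (a ≟ x)))) (sumOver-indicator A a)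
sumOver-indicator (false ∷ A) (suc a) = trans (sumOver-cong A (λ {x} _ → cong 𝟙 (⌊⌋-map′ _ _ (a ≟ x)))) (sumOver-indicator A a)

≟-false : ∀ {x y : Fin n} → x ≢ y → ⌊ x ≟ y ⌋ ≡ false
≟-false {x = x} {y} x≢y with x ≟ y
... | yes x≡y = contradiction x≡y x≢y
... | no  _   = refl

≟-true : ∀ (x : Fin n) → ⌊ x ≟ x ⌋ ≡ true
≟-true x with x ≟ x
... | yes _   = refl
... | no  x≢x = contradiction refl x≢x

lookup-⁅⁆ : ∀ (x y : Fin n) → lookup ⁅ x ⁆ y ≡ ⌊ x ≟ y ⌋
lookup-⁅⁆ zero    zero    = refl
lookup-⁅⁆ zero    (suc y) = lookup-replicate y false
lookup-⁅⁆ (suc x) zero    = refl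
lookup-⁅⁆ (suc x) (suc y) = trans (lookup-⁅⁆ x y) (sym (⌊⌋-map′ _ _ (x ≟ y)))

∉⇒lookup≡false : ∀ {A : Subset n} {i} → i ∉ A → lookup A i ≡ false
∉⇒lookup≡false {A = A} {i} i∉A = ¬-not (λ Ai≡true → i∉A (lookup⇒[]= i A Ai≡true))

subsetOf : ∀ {P : Fin n → Set} → Decidable P → Subset n
subsetOf P? = tabulate (λ i → ⌊ P? i ⌋)

∈-subsetOf⁺ : ∀ {P : Fin n → Set} (P? : Decidable P) {i} → P i → i ∈ subsetOf P?
∈-subsetOf⁺ P? {i} Pi with P? i in eq
... | yes _  = lookup⇒[]= i _ (trans (lookup∘tabulate _ i) (cong ⌊_⌋ eq))
... | no ¬Pi = contradiction Pi ¬Pi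

∈-subsetOf⁻ : ∀ {P : Fin n → Set} (P? : Decidable P) {i} → i ∈ subsetOf P? → P i
∈-subsetOf⁻ P? {i} i∈ with P? i in eq
... | yes Pi = Pi
... | no  _  = contradiction (trans (sym ([]=⇒lookup i∈)) (trans (lookup∘tabulate _ i) (cong ⌊_⌋ eq))) λ ()

∪-⊆ : ∀ {A B C : Subset n} → A ⊆ C → B ⊆ C → A ∪ B ⊆ C
∪-⊆ {A = A} {B} A⊆C B⊆C i∈ with x∈p∪q⁻ A B i∈
... | inj₁ i∈A = A⊆C i∈A
... | inj₂ i∈B = B⊆C i∈B

⁅⁆-⊆ : ∀ {A : Subset n} {i} → i ∈ A → ⁅ i ⁆ ⊆ A
⁅⁆-⊆ {i = i} i∈A j∈ = subst (_∈ _) (sym (x∈⁅y⁆⇒x≡y i j∈)) i∈A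

∣p∪q∣≡∣p∣+∣q∣ : ∀ {A B : Subset n} → Disjoint A B → ∣ A ∪ B ∣ ≡ ∣ A ∣ + ∣ B ∣
∣p∪q∣≡∣p∣+∣q∣ {A = A} {B} A#B = begin
  ∣ A ∪ B ∣                            ≡⟨ ∣p∣≡∑1 (A ∪ B) ⟩
  ∑[ i ∈ A ∪ B ] 1                     ≡⟨ sumOver-∪ A B _ A#B ⟩
  ∑[ i ∈ A ] 1 + ∑[ i ∈ B ] 1          ≡⟨ sym (cong₂ _+_ (∣p∣≡∑1 A) (∣p∣≡∑1 B)) ⟩
  ∣ A ∣ + ∣ B ∣                        ∎
  where open ≡-Reasoning

∣p∪⁅x⁆∣≡1+∣p∣ : ∀ {A : Subset n} {x} → x ∉ A → ∣ A ∪ ⁅ x ⁆ ∣ ≡ suc ∣ A ∣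
∣p∪⁅x⁆∣≡1+∣p∣ {A = A} {x} x∉A = trans (∣p∪q∣≡∣p∣+∣q∣ λ i∈A i∈⁅x⁆ → x∉A (subst (_∈ A) (x∈⁅y⁆⇒x≡y x i∈⁅x⁆) i∈A))
  (trans (cong (∣ A ∣ +_) (∣⁅x⁆∣≡1 x)) (+-comm ∣ A ∣ 1))

∣p∣+∣∁p∣≡n : ∀ (A : Subset n) → ∣ A ∣ + ∣ ∁ A ∣ ≡ n
∣p∣+∣∁p∣≡n {n} A = begin
  ∣ A ∣ + ∣ ∁ A ∣  ≡⟨ ∣p∪q∣≡∣p∣+∣q∣ {A = A} (λ i∈A i∈∁A → x∈∁p⇒x∉p i∈∁A i∈A) ⟨
  ∣ A ∪ ∁ A ∣      ≡⟨ cong ∣_∣ (p∪∁p≡⊤ A) ⟩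
  ∣ ⊤ {n} ∣        ≡⟨ ∣⊤∣≡n n ⟩
  n                ∎
  where open ≡-Reasoning

∣p∣≡1+∣p-x∣ : ∀ {A : Subset n} {x} → x ∈ A → ∣ A ∣ ≡ suc ∣ A - x ∣
∣p∣≡1+∣p-x∣ {A = A} {x} x∈A = trans (∣p∣≡∑1 A) (trans (sumOver-remove _ x∈A) (cong suc (sym (∣p∣≡∑1 (A - x)))))

sum-tabulate≡sumOver : ∀ (A : Subset n) (f : Fin n → ℕ) →
  sum (List.tabulate (λ i → if lookup A i then f i else 0)) ≡ sumOver A f
sum-tabulate≡sumOver []          f = refl
sum-tabulate≡sumOver (true ∷ A)  f = cong (f zero +_) (sum-tabulate≡sumOver A (f ∘ suc))
sum-tabulate≡sumOver (false ∷ A) f = sum-tabulate≡sumOver A (f ∘ suc)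

-- Matroid rank and closure

module MatroidProperties {m : ℕ} (N : Matroid m) where
  open Matroid N

  rank-∪-≤ : ∀ A B → rank (A ∪ B) ≤ rank A + rank B
  rank-∪-≤ A B = ≤-trans (m≤m+n _ _) (rank-sub A B)

  closure-mono : ∀ {X Y e} → X ⊆ Y → InClosure N X e → InClosure N Y e
  closure-mono {X} {Y} {e} X⊆Y e∈clX = ≤-antisym rYe≤rY (rank-mono Y (Y ∪ ⁅ e ⁆) (p⊆p∪q ⁅ e ⁆))
    where
    Xe = X ∪ ⁅ e ⁆
    Ye⊆Y∪Xe : Y ∪ ⁅ e ⁆ ⊆ Y ∪ Xe
    Ye⊆Y∪Xe = ∪-⊆ (p⊆p∪q Xe) (λ x∈e → q⊆p∪q Y Xe (q⊆p∪q X ⁅ e ⁆ x∈e))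
    X⊆Y∩Xe : X ⊆ Y ∩ Xe
    X⊆Y∩Xe x∈X = x∈p∩q⁺ (X⊆Y x∈X , p⊆p∪q ⁅ e ⁆ x∈X)
    rYe≤rY : rank (Y ∪ ⁅ e ⁆) ≤ rank Y
    rYe≤rY = +-cancelʳ-≤ (rank X) _ _ (begin
      rank (Y ∪ ⁅ e ⁆) + rank X      ≤⟨ +-mono-≤ (rank-mono _ _ Ye⊆Y∪Xe) (rank-mono _ _ X⊆Y∩Xe) ⟩
      rank (Y ∪ Xe) + rank (Y ∩ Xe)  ≤⟨ rank-sub Y Xe ⟩
      rank Y + rank Xe               ≡⟨ cong (rank Y +_) e∈clX ⟩
      rank Y + rank X                ∎)
      where open ≤-Reasoning

  ∈⇒InClosure : ∀ {X e} → e ∈ X → InClosure N X e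
  ∈⇒InClosure {X} {e} e∈X = ≤-antisym (rank-mono _ _ (∪-⊆ (λ x∈X → x∈X) (⁅⁆-⊆ e∈X))) (rank-mono _ _ (p⊆p∪q ⁅ e ⁆))

  ∉closure⇒rank< : ∀ {X e} → ¬ InClosure N X e → rank X < rank (X ∪ ⁅ e ⁆)
  ∉closure⇒rank< {X} {e} e∉clX = ≤∧≢⇒< (rank-mono _ _ (p⊆p∪q ⁅ e ⁆)) (λ eq → e∉clX (sym eq))

  independent-⊆ : ∀ {D I} → D ⊆ I → Independent N I → Independent N D
  independent-⊆ {D} {I} D⊆I I-indep = ≤-antisym (rank-≤ D) (+-cancelʳ-≤ ∣ R ∣ _ _ (begin
    ∣ D ∣ + ∣ R ∣      ≡⟨ sym (∣p∪q∣≡∣p∣+∣q∣ D#R) ⟩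
    ∣ D ∪ R ∣          ≤⟨ p⊆q⇒∣p∣≤∣q∣ D∪R⊆I ⟩
    ∣ I ∣              ≡⟨ sym I-indep ⟩
    rank I             ≤⟨ rank-mono _ _ I⊆D∪R ⟩
    rank (D ∪ R)       ≤⟨ rank-∪-≤ D R ⟩
    rank D + rank R    ≤⟨ +-monoʳ-≤ (rank D) (rank-≤ R) ⟩
    rank D + ∣ R ∣     ∎))
    where
    open ≤-Reasoning
    R = I ∩ ∁ D
    D#R : Disjoint D R
    D#R x∈D x∈R = x∈∁p⇒x∉p (proj₂ (x∈p∩q⁻ I (∁ D) x∈R)) x∈D
    D∪R⊆I : D ∪ R ⊆ I
    D∪R⊆I = ∪-⊆ D⊆I (λ x∈R → proj₁ (x∈p∩q⁻ I (∁ D) x∈R))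
    I⊆D∪R : I ⊆ D ∪ R
    I⊆D∪R {x} x∈I with x ∈? D
    ... | yes x∈D = p⊆p∪q R x∈D
    ... | no x∉D  = q⊆p∪q D R (x∈p∩q⁺ (x∈I , x∉p⇒x∈∁p x∉D))

  rank-∪-closure : ∀ T A → (∀ {e} → e ∈ A → InClosure N T e) → rank (T ∪ A) ≤ rank T
  rank-∪-closure T A A⊆clT = go ∣ A ∣ A ≤-refl A⊆clT
    where
    go : ∀ k A → ∣ A ∣ ≤ k → (∀ {e} → e ∈ A → InClosure N T e) → rank (T ∪ A) ≤ rank T
    go k A _ _ with nonempty? A
    go k A _ _ | no A-empty = ≤-reflexive (cong rank (trans (cong (T ∪_) (Empty-unique A-empty)) (∪-identityʳ T)))
    go zero A ∣A∣≤0 _ | yes (e , e∈A) = contradiction (<-≤-trans (x∈p⇒∣p-x∣<∣p∣ e∈A) ∣A∣≤0) (λ ())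
    go (suc k) A ∣A∣≤1+k A⊆clT | yes (e , e∈A) = begin
      rank (T ∪ A)                ≤⟨ rank-mono _ _ T∪A⊆ ⟩
      rank ((T ∪ (A - e)) ∪ ⁅ e ⁆) ≡⟨ closure-mono (p⊆p∪q (A - e)) (A⊆clT e∈A) ⟩
      rank (T ∪ (A - e))          ≤⟨ go k (A - e) (≤-pred (<-≤-trans (x∈p⇒∣p-x∣<∣p∣ e∈A) ∣A∣≤1+k)) (A⊆clT ∘ p─q⊆p A ⁅ e ⁆) ⟩
      rank T                      ∎
      where
      open ≤-Reasoning
      T∪A⊆ : T ∪ A ⊆ (T ∪ (A - e)) ∪ ⁅ e ⁆
      T∪A⊆ {x} x∈ with x∈p∪q⁻ T A x∈ | x ≟ e
      ... | inj₁ x∈T | _      = p⊆p∪q ⁅ e ⁆ (p⊆p∪q (A - e) x∈T)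
      ... | inj₂ _   | yes refl = q⊆p∪q _ ⁅ e ⁆ (x∈⁅x⁆ e)
      ... | inj₂ x∈A | no x≢e = p⊆p∪q ⁅ e ⁆ (q⊆p∪q T (A - e) (x∈p∧x≢y⇒x∈p-y x∈A x≢e))

  closure⇒rank≤ : ∀ T A → (∀ {e} → e ∈ A → InClosure N T e) → rank A ≤ rank T
  closure⇒rank≤ T A A⊆clT = ≤-trans (rank-mono _ _ (q⊆p∪q T A)) (rank-∪-closure T A A⊆clT)

module GraphProperties {v m : ℕ} (H : Graph v m) where

  private variable
    F F′ : Subset m
    W : Subset v
    e : Fin m
    x y z : Fin v

  Joins-sym : Joins H e x y → Joins H e y x
  Joins-sym (inj₁ p) = inj₂ p
  Joins-sym (inj₂ p) = inj₁ p

  Joins-ends : Joins H e (end₁ H e) (end₂ H e)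
  Joins-ends = inj₁ (refl , refl)

  Reach-mono : F ⊆ F′ → Reach H F x y → Reach H F′ x y
  Reach-mono F⊆F′ here               = here
  Reach-mono F⊆F′ (step e e∈F j xy) = step e (F⊆F′ e∈F) j (Reach-mono F⊆F′ xy)

  Reach-trans : Reach H F x y → Reach H F y z → Reach H F x z
  Reach-trans here               yz = yz
  Reach-trans (step e e∈F j xy) yz = step e e∈F j (Reach-trans xy yz)

  Reach-sym : Reach H F x y → Reach H F y x
  Reach-sym here               = here
  Reach-sym (step e e∈F j xy) = Reach-trans (Reach-sym xy) (step e e∈F (Joins-sym j) here)

  EndsIn : Subset v → Fin m → Set
  EndsIn W e = end₁ H e ∈ W × end₂ H e ∈ W

  EndsIn? : ∀ W → Decidable (EndsIn W)
  EndsIn? W e = end₁ H e ∈? W ×-dec end₂ H e ∈? W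

  EndsIn⇒Joins : Joins H e x y → EndsIn W e → x ∈ W × y ∈ W
  EndsIn⇒Joins (inj₁ (refl , refl)) (e₁∈W , e₂∈W) = e₁∈W , e₂∈W
  EndsIn⇒Joins (inj₂ (refl , refl)) (e₁∈W , e₂∈W) = e₂∈W , e₁∈W

  Joins⇒EndsIn : Joins H e x y → x ∈ W → y ∈ W → EndsIn W e
  Joins⇒EndsIn (inj₁ (refl , refl)) x∈W y∈W = x∈W , y∈W
  Joins⇒EndsIn (inj₂ (refl , refl)) x∈W y∈W = y∈W , x∈W

  Closed : Subset m → Subset v → Set
  Closed F W = ∀ {e x y} → e ∈ F → Joins H e x y → x ∈ W → y ∈ W

  closed⇒same-side : Closed F W → e ∈ F → lookup W (end₁ H e) ≡ lookup W (end₂ H e)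
  closed⇒same-side {W = W} {e = e} closed e∈F with end₁ H e ∈? W | end₂ H e ∈? W
  ... | yes e₁∈W | yes e₂∈W = trans ([]=⇒lookup e₁∈W) (sym ([]=⇒lookup e₂∈W))
  ... | yes e₁∈W | no  e₂∉W = contradiction (closed e∈F Joins-ends e₁∈W) e₂∉W
  ... | no  e₁∉W | yes e₂∈W = contradiction (closed e∈F (Joins-sym Joins-ends) e₂∈W) e₁∉W
  ... | no  e₁∉W | no  e₂∉W = trans (∉⇒lookup≡false e₁∉W) (sym (∉⇒lookup≡false e₂∉W))

  Reach-closed : Closed F W → Reach H F x y → x ∈ W → y ∈ W
  Reach-closed closed here               x∈W = x∈W
  Reach-closed closed (step e e∈F j xy) x∈W = Reach-closed closed xy (closed e∈F j x∈W)

  Leaving : Subset m → Subset v → Set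
  Leaving F W = ∃ λ e → e ∈ F × ∃ λ x → ∃ λ y → Joins H e x y × x ∈ W × y ∉ W

  closed-or-leaving : ∀ F W → Closed F W ⊎ Leaving F W
  closed-or-leaving F W with any? (λ e → e ∈? F ×-dec ((end₁ H e ∈? W ×-dec ¬? (end₂ H e ∈? W)) ⊎-dec (end₂ H e ∈? W ×-dec ¬? (end₁ H e ∈? W))))
  ... | yes (e , e∈F , inj₁ (x∈W , y∉W)) = inj₂ (e , e∈F , _ , _ , Joins-ends , x∈W , y∉W)
  ... | yes (e , e∈F , inj₂ (x∈W , y∉W)) = inj₂ (e , e∈F , _ , _ , Joins-sym Joins-ends , x∈W , y∉W)
  ... | no no-leaving = inj₁ closed
    where
    closed : Closed F W
    closed {e} {x} {y} e∈F j x∈W with y ∈? W | j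
    ... | yes y∈W | _                   = y∈W
    ... | no y∉W  | inj₁ (refl , refl) = contradiction (e , e∈F , inj₁ (x∈W , y∉W)) no-leaving
    ... | no y∉W  | inj₂ (refl , refl) = contradiction (e , e∈F , inj₂ (x∈W , y∉W)) no-leaving

-- Growing independent edge sets along the graph

VertexClosure : ∀ {v m} → Graph v m → Matroid m → Set
VertexClosure H N = ∀ x e → InClosure N (edgesAvoiding H x) e → e ∈ edgesAvoiding H x ⊎ IsLoopAt H e x

module Growth {v m : ℕ} (H : Graph v m) (N : Matroid m) (qg3 : VertexClosure H N) where
  open Matroid N
  open MatroidProperties N
  open GraphProperties H

  private variable
    U : Subset v
    e : Fin m
    y z : Fin v

  EndsIn⇒avoiding : EndsIn U e → z ∉ U → e ∈ edgesAvoiding H z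
  EndsIn⇒avoiding {U = U} {e = e} {z} (e₁∈U , e₂∈U) z∉U = lookup⇒[]= e _ (begin
    lookup (edgesAvoiding H z) e              ≡⟨ lookup∘tabulate _ e ⟩
    not (⌊ end₁ H e ≟ z ⌋ ∨ ⌊ end₂ H e ≟ z ⌋) ≡⟨ cong₂ (λ a b → not (a ∨ b)) (≟-false (≢z e₁∈U)) (≟-false (≢z e₂∈U)) ⟩
    true                                      ∎)
    where
    open ≡-Reasoning
    ≢z : ∀ {x} → x ∈ U → x ≢ z
    ≢z x∈U refl = z∉U x∈U

  Joins⇒¬avoiding : Joins H e y z → e ∉ edgesAvoiding H z
  Joins⇒¬avoiding {e = e} {z = z} j e∈ = contradiction (begin
    true                                        ≡⟨ []=⇒lookup e∈ ⟨
    lookup (edgesAvoiding H z) e                ≡⟨ lookup∘tabulate _ e ⟩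
    not (⌊ end₁ H e ≟ z ⌋ ∨ ⌊ end₂ H e ≟ z ⌋)   ≡⟨ cong not (incident j) ⟩
    false                                       ∎) λ ()
    where
    open ≡-Reasoning
    incident : Joins H e _ z → ⌊ end₁ H e ≟ z ⌋ ∨ ⌊ end₂ H e ≟ z ⌋ ≡ true
    incident (inj₁ (_ , refl)) = trans (cong (⌊ end₁ H e ≟ z ⌋ ∨_) (≟-true z)) (∨-zeroʳ ⌊ end₁ H e ≟ z ⌋)
    incident (inj₂ (refl , _)) = cong (_∨ ⌊ end₂ H e ≟ z ⌋) (≟-true z)

  ∉closure-avoiding : ∀ {A} → A ⊆ edgesAvoiding H z → Joins H e y z → y ≢ z → ¬ InClosure N A e
  ∉closure-avoiding {z = z} {e} A⊆ j y≢z e∈clA with qg3 z e (closure-mono A⊆ e∈clA) | j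
  ... | inj₁ e∈avoid     | _                 = Joins⇒¬avoiding j e∈avoid
  ... | inj₂ (e₁≡z , _)  | inj₁ (refl , _) = y≢z e₁≡z
  ... | inj₂ (_ , e₂≡z)  | inj₂ (_ , refl) = y≢z e₂≡z

  -- W is grown from W₀ along edges of F; the edge bringing in a new vertex z lies outside the
  -- closure of B ∪ T, because B ∪ T avoids z.
  record Extension (F : Subset m) (W₀ : Subset v) (B : Subset m) : Set where
    field
      W        : Subset v
      T        : Subset m
      W₀⊆W     : W₀ ⊆ W
      T⊆F      : T ⊆ F
      T-inside : ∀ {e} → e ∈ T → EndsIn W e
      ∣W∣      : ∣ W ∣ ≡ ∣ W₀ ∣ + ∣ T ∣
      rank-T   : rank B + ∣ T ∣ ≤ rank (B ∪ T)
      reach    : ∀ {y} → y ∈ W → ∃ λ x → x ∈ W₀ × Reach H T x y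

  module _ {F : Subset m} {W₀ : Subset v} {B : Subset m} (B-inside : ∀ {e} → e ∈ B → EndsIn W₀ e) where

    start : Extension F W₀ B
    start = record
      { W        = W₀
      ; T        = ⊥
      ; W₀⊆W     = λ x∈ → x∈
      ; T⊆F      = λ e∈⊥ → contradiction e∈⊥ ∉⊥
      ; T-inside = λ e∈⊥ → contradiction e∈⊥ ∉⊥
      ; ∣W∣      = sym (trans (cong (∣ W₀ ∣ +_) (∣⊥∣≡0 m)) (+-identityʳ _))
      ; rank-T   = ≤-reflexive (trans (trans (cong (rank B +_) (∣⊥∣≡0 m)) (+-identityʳ _)) (cong rank (sym (∪-identityʳ B))))
      ; reach    = λ {y} y∈W₀ → y , y∈W₀ , here
      }

    extend : (s : Extension F W₀ B) → e ∈ F → Joins H e y z → y ∈ Extension.W s → z ∉ Extension.W s →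
             Σ (Extension F W₀ B) λ s′ → ∣ Extension.W s′ ∣ ≡ suc ∣ Extension.W s ∣
    extend {e} {y} {z} s e∈F j y∈W z∉W = record
      { W        = W ∪ ⁅ z ⁆
      ; T        = T ∪ ⁅ e ⁆
      ; W₀⊆W     = p⊆p∪q ⁅ z ⁆ ∘ W₀⊆W
      ; T⊆F      = ∪-⊆ T⊆F (⁅⁆-⊆ e∈F)
      ; T-inside = T′-inside
      ; ∣W∣      = ∣W′∣
      ; rank-T   = rank-T′
      ; reach    = reach′
      } , ∣p∪⁅x⁆∣≡1+∣p∣ z∉W
      where
      open Extension s
      y≢z : y ≢ z
      y≢z refl = z∉W y∈W
      e∉T : e ∉ T
      e∉T e∈T = z∉W (proj₂ (EndsIn⇒Joins j (T-inside e∈T)))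
      B∪T-avoids : B ∪ T ⊆ edgesAvoiding H z
      B∪T-avoids g∈ with x∈p∪q⁻ B T g∈
      ... | inj₁ g∈B = EndsIn⇒avoiding (map W₀⊆W W₀⊆W (B-inside g∈B)) z∉W
      ... | inj₂ g∈T = EndsIn⇒avoiding (T-inside g∈T) z∉W
      W′ = W ∪ ⁅ z ⁆
      y∈W′ : y ∈ W′
      y∈W′ = p⊆p∪q ⁅ z ⁆ y∈W
      z∈W′ : z ∈ W′
      z∈W′ = q⊆p∪q W ⁅ z ⁆ (x∈⁅x⁆ z)
      T′-inside : ∀ {g} → g ∈ T ∪ ⁅ e ⁆ → EndsIn W′ g
      T′-inside g∈ with x∈p∪q⁻ T ⁅ e ⁆ g∈
      ... | inj₁ g∈T = map (p⊆p∪q ⁅ z ⁆) (p⊆p∪q ⁅ z ⁆) (T-inside g∈T)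
      ... | inj₂ g∈e rewrite x∈⁅y⁆⇒x≡y e g∈e = Joins⇒EndsIn j y∈W′ z∈W′
      ∣W′∣ : ∣ W′ ∣ ≡ ∣ W₀ ∣ + ∣ T ∪ ⁅ e ⁆ ∣
      ∣W′∣ = begin
        ∣ W ∪ ⁅ z ⁆ ∣           ≡⟨ ∣p∪⁅x⁆∣≡1+∣p∣ z∉W ⟩
        suc ∣ W ∣               ≡⟨ cong suc ∣W∣ ⟩
        suc (∣ W₀ ∣ + ∣ T ∣)    ≡⟨ +-suc _ _ ⟨
        ∣ W₀ ∣ + suc ∣ T ∣      ≡⟨ cong (∣ W₀ ∣ +_) (∣p∪⁅x⁆∣≡1+∣p∣ e∉T) ⟨
        ∣ W₀ ∣ + ∣ T ∪ ⁅ e ⁆ ∣  ∎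
        where open ≡-Reasoning
      rank-T′ : rank B + ∣ T ∪ ⁅ e ⁆ ∣ ≤ rank (B ∪ (T ∪ ⁅ e ⁆))
      rank-T′ = begin
        rank B + ∣ T ∪ ⁅ e ⁆ ∣   ≡⟨ trans (cong (rank B +_) (∣p∪⁅x⁆∣≡1+∣p∣ e∉T)) (+-suc _ _) ⟩
        suc (rank B + ∣ T ∣)     ≤⟨ s≤s rank-T ⟩
        suc (rank (B ∪ T))       ≤⟨ ∉closure⇒rank< (∉closure-avoiding B∪T-avoids j y≢z) ⟩
        rank ((B ∪ T) ∪ ⁅ e ⁆)   ≡⟨ cong rank (∪-assoc B T ⁅ e ⁆) ⟩
        rank (B ∪ (T ∪ ⁅ e ⁆))   ∎
        where open ≤-Reasoning
      reach′ : ∀ {x} → x ∈ W′ → ∃ λ w → w ∈ W₀ × Reach H (T ∪ ⁅ e ⁆) w x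
      reach′ x∈ with x∈p∪q⁻ W ⁅ z ⁆ x∈
      ... | inj₁ x∈W = map₂ (map₂ (Reach-mono (p⊆p∪q ⁅ e ⁆))) (reach x∈W)
      ... | inj₂ x∈z with x∈⁅y⁆⇒x≡y z x∈z | reach y∈W
      ...   | refl | w , w∈W₀ , w⇝y = w , w∈W₀ , Reach-trans (Reach-mono (p⊆p∪q ⁅ e ⁆) w⇝y) (step e (q⊆p∪q T ⁅ e ⁆ (x∈⁅x⁆ e)) j here)

    grow : ∃ λ (s : Extension F W₀ B) → Closed F (Extension.W s)
    grow = go v start (m≤n+m v ∣ W₀ ∣)
      where
      go : ∀ k (s : Extension F W₀ B) → v ≤ ∣ Extension.W s ∣ + k → ∃ λ s → Closed F (Extension.W s)
      go k s v≤∣W∣+k with closed-or-leaving F (Extension.W s)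
      ... | inj₁ closed = s , closed
      ... | inj₂ (e , e∈F , y , z , j , y∈W , z∉W) = continue k (extend s e∈F j y∈W z∉W) v≤∣W∣+k
        where
        continue : ∀ k → (Σ (Extension F W₀ B) λ s′ → ∣ Extension.W s′ ∣ ≡ suc ∣ Extension.W s ∣) →
                   v ≤ ∣ Extension.W s ∣ + k → ∃ λ s → Closed F (Extension.W s)
        continue zero    (s′ , ∣W′∣) v≤∣W∣+0 =
          contradiction (≤-trans (≤-reflexive (sym ∣W′∣)) (∣p∣≤n (Extension.W s′))) (≤⇒≯ (≤-trans v≤∣W∣+0 (≤-reflexive (+-identityʳ _))))
        continue (suc k) (s′ , ∣W′∣) v≤∣W∣+1+k = go k s′ (≤-trans v≤∣W∣+1+k (≤-reflexive (trans (+-suc _ k) (cong (_+ k) (sym ∣W′∣)))))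

  module _ {F : Subset m} {a : Fin v} (tree : Extension F ⁅ a ⁆ ⊥) where
    open Extension tree

    ∣W∣≡1+∣T∣ : ∣ W ∣ ≡ suc ∣ T ∣
    ∣W∣≡1+∣T∣ = trans ∣W∣ (cong (_+ ∣ T ∣) (∣⁅x⁆∣≡1 a))

    ∣T∣≤rank : ∣ T ∣ ≤ rank T
    ∣T∣≤rank = ≤-trans (m≤n+m ∣ T ∣ (rank ⊥)) (≤-trans rank-T (≤-reflexive (cong rank (∪-identityˡ T))))

  -- The growth reaches every vertex, adding v − |W₀| edges independently of B.
  spanning-bound : Connected H → ∀ {W₀ B} → Nonempty W₀ → (∀ {e} → e ∈ B → EndsIn W₀ e) →
                   rank B + v ≤ rank ⊤ + ∣ W₀ ∣
  spanning-bound connected {W₀} {B} (x₀ , x₀∈W₀) B-inside = begin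
    rank B + v                     ≡⟨ cong (rank B +_) (sym (∣⊤∣≡n v)) ⟩
    rank B + ∣ ⊤ {v} ∣             ≤⟨ +-monoʳ-≤ (rank B) (p⊆q⇒∣p∣≤∣q∣ ⊤⊆W) ⟩
    rank B + ∣ W ∣                 ≡⟨ cong (rank B +_) (trans ∣W∣ (+-comm ∣ W₀ ∣ ∣ T ∣)) ⟩
    rank B + (∣ T ∣ + ∣ W₀ ∣)      ≡⟨ +-assoc (rank B) _ _ ⟨
    rank B + ∣ T ∣ + ∣ W₀ ∣        ≤⟨ +-monoˡ-≤ ∣ W₀ ∣ (≤-trans rank-T (rank-mono _ ⊤ ⊆⊤)) ⟩
    rank ⊤ + ∣ W₀ ∣                ∎
    where
    open ≤-Reasoning
    extension = grow {F = ⊤} B-inside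
    open Extension (proj₁ extension)
    ⊤⊆W : ⊤ ⊆ W
    ⊤⊆W {y} _ = Reach-closed (proj₂ extension) (connected x₀ y) (W₀⊆W x₀∈W₀)

  rank-inside-≤ : Connected H → rank ⊤ ≤ v → ∀ {U A} → (∀ {e} → e ∈ A → EndsIn U e) → rank A ≤ ∣ U ∣
  rank-inside-≤ connected rank≤v {U} {A} A-inside with nonempty? U
  ... | yes U≠∅ = +-cancelʳ-≤ v (rank A) ∣ U ∣ (begin
    rank A + v    ≤⟨ spanning-bound connected U≠∅ A-inside ⟩
    rank ⊤ + ∣ U ∣ ≤⟨ +-monoˡ-≤ ∣ U ∣ rank≤v ⟩
    v + ∣ U ∣      ≡⟨ +-comm v ∣ U ∣ ⟩
    ∣ U ∣ + v      ∎)
    where open ≤-Reasoning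
  ... | no  U=∅ = ≤-trans (rank-≤ A) (≤-trans (≤-reflexive (trans (cong ∣_∣ (Empty-unique A=∅)) (∣⊥∣≡0 m))) z≤n)
    where
    A=∅ : Empty A
    A=∅ (e , e∈A) = U=∅ (end₁ H e , proj₁ (A-inside e∈A))

-- Degrees, simple paths and cycles

module Degrees {v m : ℕ} (H : Graph v m) where

  incidence : Fin m → Fin v → ℕ
  incidence e x = 𝟙 ⌊ end₁ H e ≟ x ⌋ + 𝟙 ⌊ end₂ H e ≟ x ⌋

  deg≡∑incidence : ∀ F x → deg H F x ≡ ∑[ e ∈ F ] incidence e x
  deg≡∑incidence F x = trans (cong sum (map-tabulate {n = m} id (λ e → if lookup F e then incidence e x else 0))) (sum-tabulate≡sumOver F (λ e → incidence e x))

  handshake : ∀ F W → ∑[ x ∈ W ] deg H F x ≡ ∑[ e ∈ F ] (𝟙 (lookup W (end₁ H e)) + 𝟙 (lookup W (end₂ H e)))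
  handshake F W = begin
    ∑[ x ∈ W ] deg H F x                                                 ≡⟨ sumOver-cong W (λ {x} _ → deg≡∑incidence F x) ⟩
    ∑[ x ∈ W ] ∑[ e ∈ F ] incidence e x                                  ≡⟨ sumOver-comm W F _ ⟩
    ∑[ e ∈ F ] ∑[ x ∈ W ] incidence e x                                  ≡⟨ sumOver-cong F (λ {e} _ → sumOver-+ W _ _) ⟩
    ∑[ e ∈ F ] (∑[ x ∈ W ] 𝟙 ⌊ end₁ H e ≟ x ⌋ + ∑[ x ∈ W ] 𝟙 ⌊ end₂ H e ≟ x ⌋)
      ≡⟨ sumOver-cong F (λ {e} _ → cong₂ _+_ (sumOver-indicator W (end₁ H e)) (sumOver-indicator W (end₂ H e))) ⟩
    ∑[ e ∈ F ] (𝟙 (lookup W (end₁ H e)) + 𝟙 (lookup W (end₂ H e)))      ∎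
    where open ≡-Reasoning

module Paths {v m : ℕ} (H : Graph v m) where
  open GraphProperties H
  open Degrees H

  private variable
    x y z w : Fin v
    e : Fin m
    F : Subset m

  data Path : Fin v → Fin v → Set where
    []   : Path x x
    cons : ∀ e → Joins H e x y → Path y z → Path x z

  vertices : Path x z → Subset v
  vertices {x} []           = ⁅ x ⁆
  vertices {x} (cons e j p) = ⁅ x ⁆ ∪ vertices p

  edges : Path x z → Subset m
  edges []           = ⊥
  edges (cons e j p) = ⁅ e ⁆ ∪ edges p

  Simple : Path x z → Set
  Simple []               = Unit
  Simple {x} (cons e j p) = x ∉ vertices p × Simple p

  start∈vertices : ∀ (p : Path x z) → x ∈ vertices p
  start∈vertices {x} []           = x∈⁅x⁆ x
  start∈vertices {x} (cons e j p) = p⊆p∪q (vertices p) (x∈⁅x⁆ x)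

  end∈vertices : ∀ (p : Path x z) → z ∈ vertices p
  end∈vertices []           = start∈vertices []
  end∈vertices {x} (cons e j p) = q⊆p∪q ⁅ x ⁆ _ (end∈vertices p)

  edges-inside : ∀ (p : Path x z) → e ∈ edges p → EndsIn (vertices p) e
  edges-inside []           e∈⊥ = contradiction e∈⊥ ∉⊥
  edges-inside {x} (cons g j p) e∈ with x∈p∪q⁻ ⁅ g ⁆ (edges p) e∈
  ... | inj₁ e∈g rewrite x∈⁅y⁆⇒x≡y g e∈g =
    Joins⇒EndsIn j (p⊆p∪q (vertices p) (x∈⁅x⁆ x)) (q⊆p∪q ⁅ x ⁆ _ (start∈vertices p))
  ... | inj₂ e∈p = map (q⊆p∪q ⁅ x ⁆ _) (q⊆p∪q ⁅ x ⁆ _) (edges-inside p e∈p)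

  simple⇒∉edges : ∀ (j : Joins H e x y) (p : Path y z) → x ∉ vertices p → e ∉ edges p
  simple⇒∉edges j p x∉p e∈p = x∉p (proj₁ (EndsIn⇒Joins j (edges-inside p e∈p)))

  Reach-vertices : ∀ (p : Path x z) → edges p ⊆ F → w ∈ vertices p → Reach H F x w
  Reach-vertices {x} [] _ w∈ rewrite x∈⁅y⁆⇒x≡y x w∈ = here
  Reach-vertices {x} (cons e j p) p⊆F w∈ with x∈p∪q⁻ ⁅ x ⁆ (vertices p) w∈
  ... | inj₁ w∈x rewrite x∈⁅y⁆⇒x≡y x w∈x = here
  ... | inj₂ w∈p = step e (p⊆F (p⊆p∪q (edges p) (x∈⁅x⁆ e))) j (Reach-vertices p (p⊆F ∘ q⊆p∪q ⁅ e ⁆ _) w∈p)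

  suffix : ∀ (p : Path x z) → Simple p → w ∈ vertices p → ∃ λ (q : Path w z) → Simple q × edges q ⊆ edges p
  suffix {x} [] _ w∈ rewrite x∈⁅y⁆⇒x≡y x w∈ = [] , _ , λ g∈⊥ → contradiction g∈⊥ ∉⊥
  suffix {x} {w = w} (cons e j p) (x∉p , p-simple) w∈ with w ≟ x
  ... | yes refl = cons e j p , (x∉p , p-simple) , λ g∈ → g∈
  ... | no w≢x with x∈p∪q⁻ ⁅ x ⁆ (vertices p) w∈
  ...   | inj₁ w∈x = contradiction (x∈⁅y⁆⇒x≡y x w∈x) w≢x
  ...   | inj₂ w∈p with suffix p p-simple w∈p
  ...     | q , q-simple , q⊆p = q , q-simple , λ g∈q → q⊆p∪q ⁅ e ⁆ (edges p) (q⊆p g∈q)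

  Reach⇒Path : Reach H F x y → ∃ λ (p : Path x y) → Simple p × edges p ⊆ F
  Reach⇒Path here = [] , _ , λ g∈⊥ → contradiction g∈⊥ ∉⊥
  Reach⇒Path {x = x} (step e e∈F j y⇝z) with Reach⇒Path y⇝z
  ... | p , p-simple , p⊆F with x ∈? vertices p
  ...   | no x∉p  = cons e j p , (x∉p , p-simple) , ∪-⊆ (⁅⁆-⊆ e∈F) p⊆F
  ...   | yes x∈p with suffix p p-simple x∈p
  ...     | q , q-simple , q⊆p = q , q-simple , λ g∈q → p⊆F (q⊆p g∈q)

  incidence-Joins : Joins H e x y → ∀ w → incidence e w ≡ 𝟙 ⌊ x ≟ w ⌋ + 𝟙 ⌊ y ≟ w ⌋
  incidence-Joins (inj₁ (refl , refl)) w = refl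
  incidence-Joins {e} (inj₂ (refl , refl)) w = +-comm (𝟙 ⌊ end₁ H e ≟ w ⌋) _

  path-degree : ∀ (p : Path x z) → Simple p → ∀ w →
    ∑[ g ∈ edges p ] incidence g w + 𝟙 ⌊ x ≟ w ⌋ + 𝟙 ⌊ z ≟ w ⌋ ≡ 2 * 𝟙 (lookup (vertices p) w)
  path-degree {x} [] _ w rewrite sumOver-⊥ (λ g → incidence g w) | lookup-⁅⁆ x w = double (⌊ x ≟ w ⌋)
    where
    double : ∀ b → 𝟙 b + 𝟙 b ≡ 2 * 𝟙 b
    double true  = refl
    double false = refl
  path-degree {x} {z} (cons {y = y} e j p) (x∉p , p-simple) w = begin
    ∑[ g ∈ ⁅ e ⁆ ∪ edges p ] incidence g w + X + Z    ≡⟨ cong (λ k → k + X + Z) (trans (sumOver-∪ ⁅ e ⁆ (edges p) _ e#p) (cong (_+ S) (sumOver-⁅⁆ e _))) ⟩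
    incidence e w + S + X + Z                          ≡⟨ cong (λ k → k + S + X + Z) (incidence-Joins j w) ⟩
    X + Y + S + X + Z                                  ≡⟨ solve 4 (λ X Y S Z → X :+ Y :+ S :+ X :+ Z := con 2 :* X :+ (S :+ Y :+ Z)) refl X Y S Z ⟩
    2 * X + (S + Y + Z)                                ≡⟨ cong (2 * X +_) (path-degree p p-simple w) ⟩
    2 * X + 2 * 𝟙 (lookup (vertices p) w)             ≡⟨ sym (*-distribˡ-+ 2 X _) ⟩
    2 * (X + 𝟙 (lookup (vertices p) w))               ≡⟨ cong (2 *_) (sym (𝟙-∨ _ _ (start-fresh w))) ⟩
    2 * 𝟙 (⌊ x ≟ w ⌋ ∨ lookup (vertices p) w)         ≡⟨ cong (λ b → 2 * 𝟙 b) (sym (trans (lookup-zipWith _∨_ w ⁅ x ⁆ _) (cong (_∨ _) (lookup-⁅⁆ x w)))) ⟩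
    2 * 𝟙 (lookup (⁅ x ⁆ ∪ vertices p) w)             ∎
    where
    open ≡-Reasoning
    X = 𝟙 ⌊ x ≟ w ⌋
    Y = 𝟙 ⌊ y ≟ w ⌋
    Z = 𝟙 ⌊ z ≟ w ⌋
    S = ∑[ g ∈ edges p ] incidence g w
    e#p : Disjoint ⁅ e ⁆ (edges p)
    e#p g∈e g∈p rewrite x∈⁅y⁆⇒x≡y e g∈e = simple⇒∉edges j p x∉p g∈p
    start-fresh : ∀ w → ⌊ x ≟ w ⌋ ≡ true → lookup (vertices p) w ≡ false
    start-fresh w x≟w with x ≟ w
    start-fresh w _ | yes refl = ¬-not (λ x∈p → x∉p (lookup⇒[]= x (vertices p) x∈p))
    start-fresh w () | no _

  cycle-from-path : ∀ (p : Path (end₁ H e) (end₂ H e)) → Simple p → e ∉ edges p → IsCycle H (⁅ e ⁆ ∪ edges p)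
  cycle-from-path {e} p p-simple e∉p = (e , p⊆p∪q (edges p) (x∈⁅x⁆ e)) , degree , connected
    where
    C = ⁅ e ⁆ ∪ edges p
    e#p : Disjoint ⁅ e ⁆ (edges p)
    e#p g∈e rewrite x∈⁅y⁆⇒x≡y e g∈e = e∉p
    degree : ∀ w → deg H C w ≡ 0 ⊎ deg H C w ≡ 2
    degree w = subst (λ d → d ≡ 0 ⊎ d ≡ 2) (sym deg≡) (two-or-zero (lookup (vertices p) w))
      where
      deg≡ : deg H C w ≡ 2 * 𝟙 (lookup (vertices p) w)
      deg≡ = begin
        deg H C w                                           ≡⟨ deg≡∑incidence C w ⟩
        ∑[ g ∈ C ] incidence g w                            ≡⟨ sumOver-∪ ⁅ e ⁆ (edges p) _ e#p ⟩
        ∑[ g ∈ ⁅ e ⁆ ] incidence g w + ∑[ g ∈ edges p ] incidence g w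
                                                            ≡⟨ cong (_+ ∑[ g ∈ edges p ] incidence g w) (sumOver-⁅⁆ e (λ g → incidence g w)) ⟩
        incidence e w + ∑[ g ∈ edges p ] incidence g w     ≡⟨ +-comm (incidence e w) _ ⟩
        ∑[ g ∈ edges p ] incidence g w + incidence e w      ≡⟨ sym (+-assoc (∑[ g ∈ edges p ] incidence g w) (𝟙 ⌊ end₁ H e ≟ w ⌋) _) ⟩
        ∑[ g ∈ edges p ] incidence g w + 𝟙 ⌊ end₁ H e ≟ w ⌋ + 𝟙 ⌊ end₂ H e ≟ w ⌋
                                                            ≡⟨ path-degree p p-simple w ⟩
        2 * 𝟙 (lookup (vertices p) w)                       ∎
        where open ≡-Reasoning
      two-or-zero : ∀ b → 2 * 𝟙 b ≡ 0 ⊎ 2 * 𝟙 b ≡ 2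
      two-or-zero true  = inj₂ refl
      two-or-zero false = inj₁ refl
    on-path : ∀ {w} → InVertexSet H C w → w ∈ vertices p
    on-path (g , g∈C , g-at-w) with x∈p∪q⁻ ⁅ e ⁆ (edges p) g∈C | g-at-w
    ... | inj₁ g∈e | inj₁ refl rewrite x∈⁅y⁆⇒x≡y e g∈e = start∈vertices p
    ... | inj₁ g∈e | inj₂ refl rewrite x∈⁅y⁆⇒x≡y e g∈e = end∈vertices p
    ... | inj₂ g∈p | inj₁ refl = proj₁ (edges-inside p g∈p)
    ... | inj₂ g∈p | inj₂ refl = proj₂ (edges-inside p g∈p)
    connected : ∀ x y → InVertexSet H C x → InVertexSet H C y → Reach H C x y
    connected x y x∈C y∈C = Reach-trans (Reach-sym (Reach-vertices p (q⊆p∪q ⁅ e ⁆ _) (on-path x∈C)))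
                                        (Reach-vertices p (q⊆p∪q ⁅ e ⁆ _) (on-path y∈C))

  fundamental-cycle : Reach H F (end₁ H e) (end₂ H e) → e ∉ F → ∃ λ C → IsCycle H C × C ⊆ F ∪ ⁅ e ⁆
  fundamental-cycle {F} {e} e₁⇝e₂ e∉F with Reach⇒Path e₁⇝e₂
  ... | p , p-simple , p⊆F =
    ⁅ e ⁆ ∪ edges p , cycle-from-path p p-simple (e∉F ∘ p⊆F) , ∪-⊆ (q⊆p∪q F ⁅ e ⁆) (p⊆p∪q ⁅ e ⁆ ∘ p⊆F)

module CycleVertices {v m : ℕ} (H : Graph v m) {C : Subset m} (cycle : IsCycle H C) where
  open GraphProperties H
  open Degrees H

  VC : Subset v
  VC = tabulate (λ x → 0 <ᵇ deg H C x)

  deg≡2*𝟙VC : ∀ x → deg H C x ≡ 2 * 𝟙 (lookup VC x)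
  deg≡2*𝟙VC x rewrite lookup∘tabulate (λ x → 0 <ᵇ deg H C x) x with proj₁ (proj₂ cycle) x
  ... | inj₁ d≡0 rewrite d≡0 = refl
  ... | inj₂ d≡2 rewrite d≡2 = refl

  positive⇒∈VC : ∀ {x} → 0 < deg H C x → x ∈ VC
  positive⇒∈VC {x} 0<d = lookup⇒[]= x VC (trans (lookup∘tabulate _ x) (positive (deg H C x) 0<d))
    where
    positive : ∀ d → 0 < d → (0 <ᵇ d) ≡ true
    positive (suc d) _ = refl

  ∈VC⇒positive : ∀ {x} → x ∈ VC → 0 < deg H C x
  ∈VC⇒positive {x} x∈VC rewrite deg≡2*𝟙VC x | []=⇒lookup x∈VC = s≤s z≤n

  ends∈VC : ∀ {e} → e ∈ C → EndsIn VC e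
  ends∈VC {e} e∈C = positive⇒∈VC (≤-trans e₁-incident (term≤ (end₁ H e)))
                  , positive⇒∈VC (≤-trans e₂-incident (term≤ (end₂ H e)))
    where
    term≤ : ∀ x → incidence e x ≤ deg H C x
    term≤ x = ≤-trans (term≤sumOver (λ g → incidence g x) e∈C) (≤-reflexive (sym (deg≡∑incidence C x)))
    e₁-incident : 0 < incidence e (end₁ H e)
    e₁-incident rewrite ≟-true (end₁ H e) = s≤s z≤n
    e₂-incident : 0 < incidence e (end₂ H e)
    e₂-incident rewrite ≟-true (end₂ H e) = m≤n⇒m≤o+n (𝟙 ⌊ end₁ H e ≟ end₂ H e ⌋) (s≤s z≤n)

  ∈VC⇒InVertexSet : ∀ {x} → x ∈ VC → InVertexSet H C x
  ∈VC⇒InVertexSet {x} x∈VC with sumOver-positive C (λ e → incidence e x) (subst (0 <_) (deg≡∑incidence C x) (∈VC⇒positive x∈VC))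
  ... | e , e∈C , 0<inc = e , e∈C , incident 0<inc
    where
    incident : ∀ {e} → 0 < incidence e x → Incident H e x
    incident {e} 0<inc with end₁ H e ≟ x | end₂ H e ≟ x
    ... | yes e₁≡x | _       = inj₁ e₁≡x
    ... | no _     | yes e₂≡x = inj₂ e₂≡x
    ... | no _     | no _     = contradiction 0<inc λ ()

  ∣C∣≡∣VC∣ : ∣ C ∣ ≡ ∣ VC ∣
  ∣C∣≡∣VC∣ = *-cancelˡ-≡ ∣ C ∣ ∣ VC ∣ 2 (begin
    2 * ∣ C ∣                                                      ≡⟨ cong (2 *_) (∣p∣≡∑1 C) ⟩
    2 * ∑[ e ∈ C ] 1                                               ≡⟨ sumOver-*ˡ C 2 _ ⟨
    ∑[ e ∈ C ] 2                                                   ≡⟨ sumOver-cong C (λ e∈C → sym (both-in (ends∈VC e∈C))) ⟩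
    ∑[ e ∈ C ] (𝟙 (lookup VC (end₁ H e)) + 𝟙 (lookup VC (end₂ H e))) ≡⟨ handshake C VC ⟨
    ∑[ x ∈ VC ] deg H C x                                          ≡⟨ sumOver-cong VC (λ {x} x∈VC → trans (deg≡2*𝟙VC x) (cong (λ b → 2 * 𝟙 b) ([]=⇒lookup x∈VC))) ⟩
    ∑[ x ∈ VC ] 2                                                  ≡⟨ sumOver-*ˡ VC 2 _ ⟩
    2 * ∑[ x ∈ VC ] 1                                              ≡⟨ cong (2 *_) (∣p∣≡∑1 VC) ⟨
    2 * ∣ VC ∣                                                     ∎)
    where
    open ≡-Reasoning
    both-in : ∀ {e} → EndsIn VC e → 𝟙 (lookup VC (end₁ H e)) + 𝟙 (lookup VC (end₂ H e)) ≡ 2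
    both-in (e₁∈ , e₂∈) rewrite []=⇒lookup e₁∈ | []=⇒lookup e₂∈ = refl

  -- A crossing edge h would make the handshake sum over W odd.
  no-bridge : ∀ {h W} → h ∈ C → Closed (C - h) W → Closed C W
  no-bridge {h} {W} h∈C closed {e} {x} {y} e∈C j x∈W with e ≟ h
  ... | no e≢h = closed (x∈p∧x≢y⇒x∈p-y e∈C e≢h) j x∈W
  ... | yes refl with y ∈? W
  ...   | yes y∈W = y∈W
  ...   | no  y∉W = ⊥-elim (even≢odd (∑[ x ∈ W ] 𝟙 (lookup VC x)) (∑[ e ∈ C - h ] 𝟙 (lookup W (end₁ H e))) (begin
    2 * ∑[ x ∈ W ] 𝟙 (lookup VC x)                 ≡⟨ sumOver-*ˡ W 2 _ ⟨
    ∑[ x ∈ W ] (2 * 𝟙 (lookup VC x))               ≡⟨ sumOver-cong W (λ {x} _ → sym (deg≡2*𝟙VC x)) ⟩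
    ∑[ x ∈ W ] deg H C x                           ≡⟨ handshake C W ⟩
    ∑[ e ∈ C ] sides e                             ≡⟨ sumOver-remove sides h∈C ⟩
    sides h + ∑[ e ∈ C - h ] sides e               ≡⟨ cong₂ _+_ (crossing j) (sumOver-cong (C - h) same-side) ⟩
    1 + ∑[ e ∈ C - h ] (2 * 𝟙 (lookup W (end₁ H e))) ≡⟨ cong suc (sumOver-*ˡ (C - h) 2 _) ⟩
    1 + 2 * ∑[ e ∈ C - h ] 𝟙 (lookup W (end₁ H e)) ∎))
    where
    open ≡-Reasoning
    sides : Fin m → ℕ
    sides e = 𝟙 (lookup W (end₁ H e)) + 𝟙 (lookup W (end₂ H e))
    crossing : Joins H h x y → sides h ≡ 1
    crossing (inj₁ (refl , refl)) rewrite []=⇒lookup x∈W | ∉⇒lookup≡false y∉W = refl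
    crossing (inj₂ (refl , refl)) rewrite []=⇒lookup x∈W | ∉⇒lookup≡false y∉W = refl
    same-side : ∀ {e} → e ∈ C - h → sides e ≡ 2 * 𝟙 (lookup W (end₁ H e))
    same-side {e} e∈C-h rewrite closed⇒same-side closed e∈C-h = cong (𝟙 (lookup W (end₂ H e)) +_) (sym (+-identityʳ _))

module FrameworkCycles {v m : ℕ} (H : Graph v m) (N : Matroid m) (qg3 : VertexClosure H N)
                       {C : Subset m} (cycle : IsCycle H C) where
  open Matroid N
  open MatroidProperties N
  open GraphProperties H
  open Growth H N qg3
  open CycleVertices H cycle

  -- A tree grown in C − h from an end of h reaches all of V(C), by no-bridge.
  cycle-minus-edge-independent : ∀ {h} → h ∈ C → Independent N (C - h)
  cycle-minus-edge-independent {h} h∈C = ≤-antisym (rank-≤ (C - h)) (≤-pred (begin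
    suc ∣ C - h ∣       ≡⟨ ∣p∣≡1+∣p-x∣ h∈C ⟨
    ∣ C ∣               ≡⟨ ∣C∣≡∣VC∣ ⟩
    ∣ VC ∣              ≤⟨ p⊆q⇒∣p∣≤∣q∣ VC⊆W ⟩
    ∣ W ∣               ≡⟨ ∣W∣≡1+∣T∣ tree ⟩
    suc ∣ T ∣           ≤⟨ s≤s (∣T∣≤rank tree) ⟩
    suc (rank T)        ≤⟨ s≤s (rank-mono _ _ T⊆F) ⟩
    suc (rank (C - h))  ∎))
    where
    open ≤-Reasoning
    p = end₁ H h
    extension = grow {F = C - h} {W₀ = ⁅ p ⁆} {B = ⊥} (λ e∈⊥ → contradiction e∈⊥ ∉⊥)
    tree = proj₁ extension
    open Extension tree
    VC⊆W : VC ⊆ W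
    VC⊆W {x} x∈VC = Reach-closed (no-bridge h∈C (proj₂ extension))
      (proj₂ (proj₂ cycle) p x (h , h∈C , inj₁ refl) (∈VC⇒InVertexSet x∈VC)) (W₀⊆W (x∈⁅x⁆ p))

  independent-unless-circuit : ¬ Circuit N C → Independent N C
  independent-unless-circuit ¬circuit with rank C ≟ℕ ∣ C ∣
  ... | yes indep = indep
  ... | no  dep   = contradiction (dep , proper-independent) ¬circuit
    where
    proper-independent : ∀ D → D ⊆ C → D ≢ C → Independent N D
    proper-independent D D⊆C D≢C with any? (λ h → h ∈? C ×-dec ¬? (h ∈? D))
    ... | yes (h , h∈C , h∉D) = independent-⊆ (λ x∈D → x∈p∧x≢y⇒x∈p-y (D⊆C x∈D) λ { refl → h∉D x∈D })
                                              (cycle-minus-edge-independent h∈C)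
    ... | no  C⊈D = contradiction (⊆-antisym D⊆C C⊆D) D≢C
      where
      C⊆D : C ⊆ D
      C⊆D {x} x∈C with x ∈? D
      ... | yes x∈D = x∈D
      ... | no  x∉D = contradiction (x , x∈C , x∉D) C⊈D

  unbalanced⇒v≤rank : Connected H → ¬ Circuit N C → v ≤ rank ⊤
  unbalanced⇒v≤rank connected ¬circuit = +-cancelˡ-≤ (rank C) v (rank ⊤) (begin
    rank C + v         ≤⟨ spanning-bound connected (end₁ H e , proj₁ (ends∈VC e∈C)) ends∈VC ⟩
    rank ⊤ + ∣ VC ∣    ≡⟨ cong (rank ⊤ +_) (trans (sym ∣C∣≡∣VC∣) (sym (independent-unless-circuit ¬circuit))) ⟩
    rank ⊤ + rank C    ≡⟨ +-comm (rank ⊤) (rank C) ⟩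
    rank C + rank ⊤    ∎)
    where
    open ≤-Reasoning
    e = proj₁ (proj₁ cycle)
    e∈C = proj₂ (proj₁ cycle)

-- Sets with balanced complement

module BalancedDeletion {v m : ℕ} (H : Graph v m) (N : Matroid m) (qg3 : VertexClosure H N)
                        {X : Subset m} (balanced : BalancedDel H N X) where
  open Matroid N
  open MatroidProperties N
  open GraphProperties H
  open Paths H using (fundamental-cycle)
  open Growth H N qg3

  -- Otherwise T ∪ {e} would be independent and contain a cycle avoiding X.
  joined⇒spanned : ∀ {T e} → T ⊆ ∁ X → ∣ T ∣ ≤ rank T → e ∉ X → Reach H T (end₁ H e) (end₂ H e) → InClosure N T e
  joined⇒spanned {T} {e} T⊆∁X T-indep e∉X e₁⇝e₂ with rank (T ∪ ⁅ e ⁆) ≟ℕ rank T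
  ... | yes spanned = spanned
  ... | no  e∉clT with fundamental-cycle e₁⇝e₂ (λ e∈T → e∉clT (∈⇒InClosure e∈T))
  ...   | C , C-cycle , C⊆T+e = ⊥-elim (proj₁ (balanced C C-cycle avoids-X) (independent-⊆ C⊆T+e T+e-independent))
    where
    avoids-X : ∀ g → g ∈ C → g ∉ X
    avoids-X g g∈C = x∈∁p⇒x∉p (∪-⊆ T⊆∁X (⁅⁆-⊆ (x∉p⇒x∈∁p e∉X)) (C⊆T+e g∈C))
    T+e-independent : Independent N (T ∪ ⁅ e ⁆)
    T+e-independent = ≤-antisym (rank-≤ _) (begin
      ∣ T ∪ ⁅ e ⁆ ∣       ≡⟨ ∣p∪⁅x⁆∣≡1+∣p∣ (λ e∈T → e∉clT (∈⇒InClosure e∈T)) ⟩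
      suc ∣ T ∣           ≤⟨ s≤s T-indep ⟩
      suc (rank T)        ≤⟨ ∉closure⇒rank< e∉clT ⟩
      rank (T ∪ ⁅ e ⁆)    ∎)
      where open ≤-Reasoning

  rank-∁-< : Connected H → rank ⊤ ≤ v → Fin v → rank (∁ X) < v
  rank-∁-< connected rank≤v a = ≰⇒> λ v≤rankF → 1+n≰n (begin
    suc ∣ T ∣     ≡⟨ ∣W∣≡1+∣T∣ tree ⟨
    ∣ W ∣         ≤⟨ +-cancelʳ-≤ ∣ ∁ W ∣ ∣ W ∣ (rank FW) (W-bound v≤rankF) ⟩
    rank FW       ≤⟨ closure⇒rank≤ T FW FW-spanned ⟩
    rank T        ≤⟨ rank-≤ T ⟩
    ∣ T ∣         ∎)
    where
    open ≤-Reasoning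
    F = ∁ X
    extension = grow {F = F} {W₀ = ⁅ a ⁆} {B = ⊥} (λ e∈⊥ → contradiction e∈⊥ ∉⊥)
    tree = proj₁ extension
    closed = proj₂ extension
    open Extension tree
    FW FO : Subset m
    FW = F ∩ subsetOf (EndsIn? W)
    FO = F ∩ subsetOf (EndsIn? (∁ W))
    F⊆FW∪FO : F ⊆ FW ∪ FO
    F⊆FW∪FO {e} e∈F with end₁ H e ∈? W
    ... | yes e₁∈W = p⊆p∪q FO (x∈p∩q⁺ (e∈F , ∈-subsetOf⁺ (EndsIn? W) (e₁∈W , closed e∈F Joins-ends e₁∈W)))
    ... | no  e₁∉W = q⊆p∪q FW FO (x∈p∩q⁺ (e∈F , ∈-subsetOf⁺ (EndsIn? (∁ W)) (x∉p⇒x∈∁p e₁∉W , x∉p⇒x∈∁p e₂∉W)))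
      where
      e₂∉W : end₂ H e ∉ W
      e₂∉W e₂∈W = e₁∉W (closed e∈F (Joins-sym Joins-ends) e₂∈W)
    W-bound : v ≤ rank F → ∣ W ∣ + ∣ ∁ W ∣ ≤ rank FW + ∣ ∁ W ∣
    W-bound v≤rankF = begin
      ∣ W ∣ + ∣ ∁ W ∣     ≡⟨ ∣p∣+∣∁p∣≡n W ⟩
      v                   ≤⟨ v≤rankF ⟩
      rank F              ≤⟨ rank-mono _ _ F⊆FW∪FO ⟩
      rank (FW ∪ FO)      ≤⟨ rank-∪-≤ FW FO ⟩
      rank FW + rank FO   ≤⟨ +-monoʳ-≤ (rank FW) (rank-inside-≤ connected rank≤v (λ e∈FO → ∈-subsetOf⁻ (EndsIn? (∁ W)) (proj₂ (x∈p∩q⁻ F _ e∈FO)))) ⟩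
      rank FW + ∣ ∁ W ∣   ∎
    from-a : ∀ {y} → y ∈ W → Reach H T a y
    from-a y∈W with reach y∈W
    ... | x , x∈⁅a⁆ , x⇝y rewrite x∈⁅y⁆⇒x≡y a x∈⁅a⁆ = x⇝y
    FW-spanned : ∀ {e} → e ∈ FW → InClosure N T e
    FW-spanned e∈FW with x∈p∩q⁻ F _ e∈FW
    ... | e∈F , e∈W = joined⇒spanned (λ g∈T → T⊆F g∈T) (∣T∣≤rank tree) (x∈∁p⇒x∉p e∈F)
        (Reach-trans (Reach-sym (from-a (proj₁ ends))) (from-a (proj₂ ends)))
      where ends = ∈-subsetOf⁻ (EndsIn? W) e∈W

module _ {m : ℕ} (N : Matroid m) where
  open Matroid N

  -- With r(X) + r(E − X) = r(E) + κ, the pair (X, E − X) would be a (κ+1)-separation.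
  rank-≥-connectivity : ∀ {n X} → NConnected N n → n ≤ rank ⊤ → rank (∁ X) < rank ⊤ → n ≤ rank X
  rank-≥-connectivity {n} {X} n-connected n≤R ∁X<R with n ≤? rank X
  ... | yes n≤rX = n≤rX
  ... | no  n≰rX = contradiction separation (n-connected (suc κ) X (s≤s z≤n) (≤-<-trans k≤rX rX<n))
    where
    open ≤-Reasoning
    R = rank ⊤
    rX = rank X
    r∁X = rank (∁ X)
    rX<n : rX < n
    rX<n = ≰⇒> n≰rX
    R≤rX+r∁X : R ≤ rX + r∁X
    R≤rX+r∁X = ≤-trans (≤-reflexive (cong rank (sym (p∪∁p≡⊤ X)))) (MatroidProperties.rank-∪-≤ N X (∁ X))
    κ = proj₁ (m≤n⇒∃[o]m+o≡n R≤rX+r∁X)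
    R+κ≡ : R + κ ≡ rX + r∁X
    R+κ≡ = proj₂ (m≤n⇒∃[o]m+o≡n R≤rX+r∁X)
    k≤rX : suc κ ≤ rX
    k≤rX = +-cancelˡ-≤ R (suc κ) rX (begin
      R + suc κ        ≡⟨ trans (+-suc R κ) (cong suc R+κ≡) ⟩
      suc (rX + r∁X)   ≡⟨ +-suc rX r∁X ⟨
      rX + suc r∁X     ≤⟨ +-monoʳ-≤ rX ∁X<R ⟩
      rX + R           ≡⟨ +-comm rX R ⟩
      R + rX           ∎)
    k≤r∁X : suc κ ≤ r∁X
    k≤r∁X = +-cancelˡ-≤ R (suc κ) r∁X (begin
      R + suc κ        ≡⟨ trans (+-suc R κ) (cong suc R+κ≡) ⟩
      suc rX + r∁X     ≤⟨ +-monoˡ-≤ r∁X (≤-trans rX<n n≤R) ⟩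
      R + r∁X          ∎)
    separation : Separation N (suc κ) X
    separation = ≤-trans k≤rX (rank-≤ X) , ≤-trans k≤r∁X (rank-≤ (∁ X))
               , subst (_< R + suc κ) R+κ≡ (+-monoʳ-< R (n<1+n κ))

framework-rank≤v : ∀ {v m} (H : Graph v m) (N : Matroid m) → IsFramework H N → Connected H → Fin v → Matroid.rank N ⊤ ≤ v
framework-rank≤v {v} H N (qg2 , _) connected x =
  ≤-trans (qg2 x ⊤ ⊤ (λ y → (λ _ → connected x y) , (λ _ → ∈⊤)) (λ e → (λ _ → ∈⊤ , ∈⊤) , (λ _ → ∈⊤)))
          (≤-reflexive (∣⊤∣≡n v))

lemma5p3 : ∀ {v m : ℕ} (n : ℕ) (H : Graph v m) (N : Matroid m) →
    IsFramework H N → Connected H → NConnected N n → n ≤ v →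
    Unbalanced H N →
    ∀ (X : Subset m) → BalancedDel H N X → n ≤ Matroid.rank N X
lemma5p3 {v} n H N framework@(_ , qg3 , _) connected n-connected n≤v (C , C-cycle , C-unbalanced) X balanced =
  rank-≥-connectivity N n-connected (≤-trans n≤v v≤rank) (<-≤-trans (rank-∁-< connected rank≤v a) v≤rank)
  where
  open BalancedDeletion H N qg3 balanced
  a = end₁ H (proj₁ (proj₁ C-cycle))
  rank≤v : Matroid.rank N ⊤ ≤ v
  rank≤v = framework-rank≤v H N framework connected a
  v≤rank : v ≤ Matroid.rank N ⊤
  v≤rank = FrameworkCycles.unbalanced⇒v≤rank H N qg3 C-cycle connected C-unbalanced
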